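{- Let $q=p^r$ with $p$ an odd prime and $r\ge 1$. Let $G\cong \mathrm{PGL}_2(q)$ be a string C-group of rank $4$ with distinguished generators $\rho_0,\rho_1,\rho_2,\rho_3$, and let $G_0=\langle\rho_1,\rho_2,\rho_3\rangle$ and $G_3=\langle\rho_0,\rho_1,\rho_2\rangle$. Then neither $G_0$ nor $G_3$ is isomorphic to a semidirect product $E_{p^m}\rtimes Z_d$ of an elementary abelian group $E_{p^m}$ of order $p^m$, $m\le r$, by a cyclic group $Z_d$ of order $d$ with $d\mid q-1$ and $d\mid p^m-1$ (such semidirect products being those occurring as subgroups of $\mathrm{PGL}_2(q)$).
   Context: A string C-group of rank $4$ is a group $G$ generated by four pairwise distinct involutions $\rho_0,\rho_1,\rho_2,\rho_3$ satisfying $(\rho_j\rho_k)^2=1$ whenever $|j-k|\ge 2$, and the intersection property $\langle \rho_j : j\in J\rangle\cap\langle \rho_j : j\in K\rangle=\langle \rho_j : j\in J\cap K\rangle$ for all $J,K\subseteq\{0,1,2,3\}$. -}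

module Defs where

open import Level using (Level; _⊔_; suc)
open import Algebra.Bundles using (Group; CommutativeRing)
open import Data.Nat as ℕ using (ℕ; zero; _∸_; _^_; _≤_)
open import Data.Nat.Divisibility using (_∣_)
open import Data.Nat.Primality using (Prime)
open import Data.Fin using (Fin; toℕ)
open import Data.Fin.Subset using (Subset; _∈_; _∩_)
open import Data.Product using (Σ; ∃; _×_; _,_)
open import Data.Unit using (⊤)
open import Relation.Nullary using (¬_)
open import Relation.Binary.PropositionalEquality using (_≡_; _≢_)
open import Function.Bundles using (_⇔_)

-- Finite cardinality of a subset (given as a predicate) of a setoid:
-- "P has exactly n elements" = there is an injective (up to ≈)
-- enumeration Fin n → A of P that hits every element of P up to ≈.

HasSize : ∀ {a ℓ p} {A : Set a} (_≈_ : A → A → Set ℓ) (P : A → Set p) (n : ℕ)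
        → Set (a ⊔ ℓ ⊔ p)
HasSize {A = A} _≈_ P n =
  Σ (Fin n → A) λ f →
    (∀ i → P (f i)) ×
    (∀ i j → f i ≈ f j → i ≡ j) ×
    (∀ x → P x → ∃ λ i → x ≈ f i)

record Field (c ℓ : Level) : Set (suc (c ⊔ ℓ)) where
  field
    commutativeRing : CommutativeRing c ℓ
  open CommutativeRing commutativeRing public
  field
    1≉0     : ¬ (1# ≈ 0#)
    inverse : ∀ x → ¬ (x ≈ 0#) → ∃ λ y → (x * y) ≈ 1#

FieldOfOrder : ∀ {c ℓ} → Field c ℓ → ℕ → Set (c ⊔ ℓ)
FieldOfOrder F q = HasSize (Field._≈_ F) (λ _ → ⊤) q

-- 2×2 matrices over a field, and PGL₂ as invertible matrices modulo
-- nonzero scalars (expressed as a setoid relation, no quotient types).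

module Matrices {c ℓ} (F : Field c ℓ) where
  open Field F

  record M2 : Set c where
    constructor mat
    field a b c' d : Carrier
  open M2 public

  det : M2 → Carrier
  det M = (a M * d M) - (b M * c' M)

  Invertible : M2 → Set ℓ
  Invertible M = ¬ (det M ≈ 0#)

  _·_ : M2 → M2 → M2
  M · N = mat (a M * a N + b M * c' N) (a M * b N + b M * d N)
              (c' M * a N + d M * c' N) (c' M * b N + d M * d N)

  _∼_ : M2 → M2 → Set (c ⊔ ℓ)
  M ∼ N = ∃ λ s → ¬ (s ≈ 0#) ×
            (a M ≈ s * a N) × (b M ≈ s * b N) ×
            (c' M ≈ s * c' N) × (d M ≈ s * d N)

-- Group G is isomorphic to PGL₂(F) = GL₂(F)/Z(GL₂(F)):
-- a map φ : G → GL₂(F) inducing a bijective homomorphism onto the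
-- quotient by scalars.

IsoToPGL2 : ∀ {c ℓ c' ℓ'} → Group c ℓ → Field c' ℓ' → Set (c ⊔ ℓ ⊔ c' ⊔ ℓ')
IsoToPGL2 G F =
  Σ (Carrier → M2) λ φ →
    (∀ x → Invertible (φ x)) ×
    (∀ x y → (x ≈ y) ⇔ (φ x ∼ φ y)) ×
    (∀ x y → φ (x ∙ y) ∼ (φ x · φ y)) ×
    (∀ M → Invertible M → ∃ λ x → M ∼ φ x)
  where open Group G
        open Matrices F

module GroupNotions {c ℓ} (G : Group c ℓ) where
  open Group G

  data ⟨_⟩ {p} (S : Carrier → Set p) : Carrier → Set (c ⊔ ℓ ⊔ p) where
    gen  : ∀ {x} → S x → ⟨ S ⟩ x
    unit : ⟨ S ⟩ ε
    mul  : ∀ {x y} → ⟨ S ⟩ x → ⟨ S ⟩ y → ⟨ S ⟩ (x ∙ y)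
    inv  : ∀ {x} → ⟨ S ⟩ x → ⟨ S ⟩ (x ⁻¹)
    resp : ∀ {x y} → x ≈ y → ⟨ S ⟩ x → ⟨ S ⟩ y

  record IsSubgroup {p} (H : Carrier → Set p) : Set (c ⊔ ℓ ⊔ p) where
    field
      resp-≈ : ∀ {x y} → x ≈ y → H x → H y
      ε∈     : H ε
      ∙-closed : ∀ {x y} → H x → H y → H (x ∙ y)
      ⁻¹-closed : ∀ {x} → H x → H (x ⁻¹)

  _⊆_ : ∀ {p q} → (Carrier → Set p) → (Carrier → Set q) → Set (c ⊔ p ⊔ q)
  A ⊆ B = ∀ {x} → A x → B x

  pow : Carrier → ℕ → Carrier
  pow x zero = ε
  pow x (ℕ.suc n) = x ∙ pow x n

  -- K (a subgroup) is isomorphic to a semidirect product E_{p^m} ⋊ Z_d: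
  -- K is the internal semidirect product N ⋊ C of a normal elementary
  -- abelian subgroup N of order p^m and a cyclic subgroup C of order d.
  IsSemidirectEZ : ∀ {k} → (Carrier → Set k) → (p m d : ℕ) → Set (suc (c ⊔ ℓ) ⊔ k)
  IsSemidirectEZ K p m d =
    Σ (Carrier → Set (c ⊔ ℓ)) λ N → Σ Carrier λ g →
      let C = ⟨ (λ y → y ≈ g) ⟩ in
      IsSubgroup N × N ⊆ K ×
      HasSize _≈_ N (p ^ m) ×
      (∀ {x y} → N x → N y → (x ∙ y) ≈ (y ∙ x)) ×
      (∀ {x} → N x → pow x p ≈ ε) ×
      (∀ {x h} → N x → K h → N ((h ∙ x) ∙ (h ⁻¹))) ×
      K g ×
      HasSize _≈_ C d ×
      (∀ {x} → N x → C x → x ≈ ε) ×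
      (∀ {x} → K x → ∃ λ n → ∃ λ z → N n × C z × x ≈ (n ∙ z))

record StringCGroup4 {c ℓ} (G : Group c ℓ) : Set (c ⊔ ℓ) where
  open Group G
  open GroupNotions G
  field
    ρ : Fin 4 → Carrier
    involution : ∀ i → (ρ i ∙ ρ i) ≈ ε
    nontrivial : ∀ i → ¬ (ρ i ≈ ε)
    distinct   : ∀ i j → i ≢ j → ¬ (ρ i ≈ ρ j)
    generates  : ∀ x → ⟨ (λ y → ∃ λ i → y ≈ ρ i) ⟩ x
    commuting  : ∀ i j → 2 ℕ.≤ (toℕ i ∸ toℕ j) ℕ.+ (toℕ j ∸ toℕ i) →
                 ((ρ i ∙ ρ j) ∙ (ρ i ∙ ρ j)) ≈ ε
  G[_] : Subset 4 → Carrier → Set (c ⊔ ℓ)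
  G[ J ] = ⟨ (λ y → ∃ λ i → i ∈ J × y ≈ ρ i) ⟩
  field
    intersection : ∀ J K {x} → G[ J ] x → G[ K ] x → G[ J ∩ K ] x

open import Data.Vec using ([]; _∷_)
open import Data.Fin.Subset using (inside; outside)

I₁₂₃ : Subset 4
I₁₂₃ = outside ∷ inside ∷ inside ∷ inside ∷ []

I₀₁₂ : Subset 4
I₀₁₂ = inside ∷ inside ∷ inside ∷ outside ∷ []

module Submission where

--   If a subgroup K = N ⋊ ⟨g⟩ is the internal semidirect product of a
--   normal subgroup N without involutions (e.g. N has odd exponent p)
--   and a cyclic subgroup ⟨g⟩, then K contains no two distinct
--   commuting involutions (no Klein four-subgroup).
--
-- Indeed, the ⟨g⟩-component of an involution of K is itself an
-- involution, and a cyclic group has at most one involution (proved by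
-- a Euclid-style descent on exponents).  So two commuting involutions
-- a, b have the same ⟨g⟩-component, whence ab ∈ N; as ab is an
-- involution or trivial, ab = 1 and a = b.  In a string C-group the
-- generators ρ₁, ρ₃ of G₀ (resp. ρ₀, ρ₂ of G₃) are distinct commuting
-- involutions, so neither G₀ nor G₃ is such a semidirect product.

open import Defs
open import Algebra.Bundles using (Group)
open import Data.Nat using (ℕ; _≤_; _^_; _∸_)
open import Data.Nat.Divisibility using (_∣_)
open import Data.Nat.Primality using (Prime)
open import Data.Product using (_×_)
open import Relation.Nullary using (¬_)
open import Relation.Binary.PropositionalEquality using (_≢_)

open import Data.Nat using (zero; suc; _+_; _*_; _%_; _/_; z≤n; s≤s; s≤s⁻¹)
open import Data.Nat.Properties using (≤-total; ≤-refl; ≤-trans; ≤-reflexive; +-comm; m≤n+m; m+[n∸m]≡n)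
open import Data.Nat.DivMod using (m≡m%n+[m/n]*n; m%n<n)
open import Data.Nat.Divisibility using (divides)
open import Data.Nat.Primality using (prime⇒irreducible)
open import Data.Product using (∃; ∃₂; _,_)
open import Level using (_⊔_)
open import Data.Sum using (inj₁; inj₂)
open import Data.Empty using (⊥; ⊥-elim)
open import Data.Fin using (Fin; toℕ; #_)
open import Data.Fin.Subset using (_∈_)
open import Data.Vec.Base using (here; there)
open import Relation.Binary.PropositionalEquality as ≡ using (_≡_)
import Algebra.Properties.Group as GroupProperties
import Relation.Binary.Reasoning.Setoid as SetoidReasoning

-- An odd prime p has the form 2k + 1 (k = p / 2): if p were even,
-- 2 would be a divisor of p other than 1 and p.
odd-prime : ∀ {p} → Prime p → p ≢ 2 → ∃ λ k → p ≡ suc (k * 2)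
odd-prime {p} p-prime p≢2 with p % 2 | m≡m%n+[m/n]*n p 2 | m%n<n p 2
... | 0 | p≡[p/2]*2 | _ with prime⇒irreducible p-prime (divides (p / 2) p≡[p/2]*2)
...   | inj₁ ()
...   | inj₂ 2≡p = ⊥-elim (p≢2 (≡.sym 2≡p))
odd-prime {p} _ _ | 1 | p≡1+[p/2]*2 | _ = p / 2 , p≡1+[p/2]*2
odd-prime _ _ | suc (suc _) | _ | s≤s (s≤s ())

-- Exponent-sum bound for one step of the descent in a cyclic group
-- (powers-not-distinct-involutions): (i, j) ↦ (i, j - i).
descent-bound : ∀ {i j n} → i ≤ j → suc i + suc j ≤ suc n → suc i + (j ∸ i) ≤ n
descent-bound {i} {j} i≤j le =
  ≤-trans (≤-reflexive (≡.cong suc (m+[n∸m]≡n i≤j))) (≤-trans (m≤n+m (suc j) i) (s≤s⁻¹ le))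

module GroupFacts {c ℓ} (G : Group c ℓ) where
  open Group G
  open GroupNotions G
  open GroupProperties G using (inverseˡ-unique; inverseʳ-unique; ⁻¹-anti-homo-∙)
  open SetoidReasoning setoid

  Commute : Carrier → Carrier → Set ℓ
  Commute x y = (x ∙ y) ≈ (y ∙ x)

  IsInvolution : Carrier → Set ℓ
  IsInvolution x = ((x ∙ x) ≈ ε) × ¬ (x ≈ ε)

  DistinctInvolutions : Carrier → Carrier → Set ℓ
  DistinctInvolutions x y = IsInvolution x × IsInvolution y × ¬ (x ≈ y)

  distinct-sym : ∀ {x y} → DistinctInvolutions x y → DistinctInvolutions y x
  distinct-sym (x-inv , y-inv , x≉y) = y-inv , x-inv , λ y≈x → x≉y (sym y≈x)

  distinct-resp : ∀ {x x′ y y′} → x ≈ x′ → y ≈ y′ →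
                  DistinctInvolutions x y → DistinctInvolutions x′ y′
  distinct-resp x≈x′ y≈y′ ((x² , x≉ε) , (y² , y≉ε) , x≉y) =
    (trans (∙-cong (sym x≈x′) (sym x≈x′)) x² , λ e → x≉ε (trans x≈x′ e)) ,
    (trans (∙-cong (sym y≈y′) (sym y≈y′)) y² , λ e → y≉ε (trans y≈y′ e)) ,
    λ e → x≉y (trans x≈x′ (trans e (sym y≈y′)))

  involution-self-inverse : ∀ {x} → (x ∙ x) ≈ ε → (x ⁻¹) ≈ x
  involution-self-inverse {x} x² = sym (inverseʳ-unique x x x²)

  interchange : ∀ {a b c d} → Commute b c → ((a ∙ b) ∙ (c ∙ d)) ≈ ((a ∙ c) ∙ (b ∙ d))
  interchange {a} {b} {c} {d} bc≈cb = begin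
    (a ∙ b) ∙ (c ∙ d) ≈⟨ assoc _ _ _ ⟩
    a ∙ (b ∙ (c ∙ d)) ≈⟨ ∙-congˡ (sym (assoc _ _ _)) ⟩
    a ∙ ((b ∙ c) ∙ d) ≈⟨ ∙-congˡ (∙-congʳ bc≈cb) ⟩
    a ∙ ((c ∙ b) ∙ d) ≈⟨ ∙-congˡ (assoc _ _ _) ⟩
    a ∙ (c ∙ (b ∙ d)) ≈⟨ sym (assoc _ _ _) ⟩
    (a ∙ c) ∙ (b ∙ d) ∎

  twisted-product : ∀ n z m → ((n ∙ z) ∙ (m ∙ z)) ≈ ((n ∙ ((z ∙ m) ∙ z ⁻¹)) ∙ (z ∙ z))
  twisted-product n z m = begin
    (n ∙ z) ∙ (m ∙ z)                 ≈⟨ assoc _ _ _ ⟩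
    n ∙ (z ∙ (m ∙ z))                 ≈⟨ ∙-congˡ (sym (assoc _ _ _)) ⟩
    n ∙ ((z ∙ m) ∙ z)                 ≈⟨ ∙-congˡ (∙-congˡ (sym (identityˡ z))) ⟩
    n ∙ ((z ∙ m) ∙ (ε ∙ z))           ≈⟨ ∙-congˡ (∙-congˡ (∙-congʳ (sym (inverseˡ z)))) ⟩
    n ∙ ((z ∙ m) ∙ ((z ⁻¹ ∙ z) ∙ z))  ≈⟨ ∙-congˡ (∙-congˡ (assoc _ _ _)) ⟩
    n ∙ ((z ∙ m) ∙ (z ⁻¹ ∙ (z ∙ z)))  ≈⟨ ∙-congˡ (sym (assoc _ _ _)) ⟩
    n ∙ (((z ∙ m) ∙ z ⁻¹) ∙ (z ∙ z))  ≈⟨ sym (assoc _ _ _) ⟩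
    (n ∙ ((z ∙ m) ∙ z ⁻¹)) ∙ (z ∙ z)  ∎

  -- If a and c commute and a, ac are distinct involutions, then so are
  -- a, c: this is one step of the descent in a cyclic group.
  shorten : ∀ {a b c} → Commute a c → b ≈ (a ∙ c) →
            DistinctInvolutions a b → DistinctInvolutions a c
  shorten {a} {b} {c} ac≈ca b≈ac ((a² , a≉ε) , (b² , b≉ε) , a≉b) =
    (a-inv , (c² , c≉ε) , a≉c)
    where
    a-inv : IsInvolution a
    a-inv = a² , a≉ε
    c² : (c ∙ c) ≈ ε
    c² = begin
      c ∙ c              ≈⟨ sym (identityˡ _) ⟩
      ε ∙ (c ∙ c)        ≈⟨ ∙-congʳ (sym a²) ⟩
      (a ∙ a) ∙ (c ∙ c)  ≈⟨ interchange (sym ac≈ca) ⟨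
      (a ∙ c) ∙ (a ∙ c)  ≈⟨ ∙-cong b≈ac b≈ac ⟨
      b ∙ b              ≈⟨ b² ⟩
      ε                  ∎
    c≉ε : ¬ (c ≈ ε)
    c≉ε c≈ε = a≉b (sym (trans b≈ac (trans (∙-congˡ c≈ε) (identityʳ a))))
    a≉c : ¬ (a ≈ c)
    a≉c a≈c = b≉ε (trans b≈ac (trans (∙-congˡ (sym a≈c)) a²))

  pow-+ : ∀ x m n → pow x (m + n) ≈ (pow x m ∙ pow x n)
  pow-+ x zero n = sym (identityˡ _)
  pow-+ x (suc m) n = begin
    x ∙ pow x (m + n)        ≈⟨ ∙-congˡ (pow-+ x m n) ⟩
    x ∙ (pow x m ∙ pow x n)  ≈⟨ assoc _ _ _ ⟨
    (x ∙ pow x m) ∙ pow x n  ∎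

  pow-split : ∀ x {i j} → i ≤ j → pow x j ≈ (pow x i ∙ pow x (j ∸ i))
  pow-split x {i} {j} i≤j = begin
    pow x j                    ≡⟨ ≡.cong (pow x) (m+[n∸m]≡n i≤j) ⟨
    pow x (i + (j ∸ i))        ≈⟨ pow-+ x i (j ∸ i) ⟩
    pow x i ∙ pow x (j ∸ i)    ∎

  pow-commute : ∀ {x y} → Commute x y → ∀ m → Commute (pow x m) y
  pow-commute {x} {y} xy≈yx zero = trans (identityˡ y) (sym (identityʳ y))
  pow-commute {x} {y} xy≈yx (suc m) = begin
    (x ∙ pow x m) ∙ y  ≈⟨ assoc _ _ _ ⟩
    x ∙ (pow x m ∙ y)  ≈⟨ ∙-congˡ (pow-commute xy≈yx m) ⟩
    x ∙ (y ∙ pow x m)  ≈⟨ sym (assoc _ _ _) ⟩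
    (x ∙ y) ∙ pow x m  ≈⟨ ∙-congʳ xy≈yx ⟩
    (y ∙ x) ∙ pow x m  ≈⟨ assoc _ _ _ ⟩
    y ∙ (x ∙ pow x m)  ∎

  pows-commute : ∀ {x y} → Commute x y → ∀ m n → Commute (pow x m) (pow y n)
  pows-commute xy≈yx m n = pow-commute (sym (pow-commute (sym xy≈yx) n)) m

  -- Even powers of an involution are trivial; pow x (suc k * 2)
  -- unfolds definitionally to x ∙ (x ∙ pow x (k * 2)).
  involution-even-power : ∀ {x} → (x ∙ x) ≈ ε → ∀ k → pow x (k * 2) ≈ ε
  involution-even-power x² zero = refl
  involution-even-power {x} x² (suc k) = begin
    x ∙ (x ∙ pow x (k * 2))  ≈⟨ assoc _ _ _ ⟨
    (x ∙ x) ∙ pow x (k * 2)  ≈⟨ ∙-cong x² (involution-even-power x² k) ⟩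
    ε ∙ ε                    ≈⟨ identityˡ ε ⟩
    ε                        ∎

  involution-odd-order-trivial : ∀ {x} k → (x ∙ x) ≈ ε → pow x (suc (k * 2)) ≈ ε → x ≈ ε
  involution-odd-order-trivial {x} k x² x^p≈ε = begin
    x                     ≈⟨ identityʳ x ⟨
    x ∙ ε                 ≈⟨ ∙-congˡ (involution-even-power x² k) ⟨
    x ∙ pow x (k * 2)     ≈⟨ x^p≈ε ⟩
    ε                     ∎

  ⟨⟩-isSubgroup : ∀ {p} {S : Carrier → Set p} → IsSubgroup ⟨ S ⟩
  ⟨⟩-isSubgroup = record { resp-≈ = resp ; ε∈ = unit ; ∙-closed = mul ; ⁻¹-closed = inv }

  ⟨⟩-least : ∀ {p h} {S : Carrier → Set p} {H : Carrier → Set h} →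
             IsSubgroup H → S ⊆ H → ⟨ S ⟩ ⊆ H
  ⟨⟩-least H-sub S⊆H (gen s) = S⊆H s
  ⟨⟩-least H-sub S⊆H unit = IsSubgroup.ε∈ H-sub
  ⟨⟩-least H-sub S⊆H (mul u v) = IsSubgroup.∙-closed H-sub (⟨⟩-least H-sub S⊆H u) (⟨⟩-least H-sub S⊆H v)
  ⟨⟩-least H-sub S⊆H (inv u) = IsSubgroup.⁻¹-closed H-sub (⟨⟩-least H-sub S⊆H u)
  ⟨⟩-least H-sub S⊆H (resp e u) = IsSubgroup.resp-≈ H-sub e (⟨⟩-least H-sub S⊆H u)

  module Cyclic (g : Carrier) where
    C : Carrier → Set (c ⊔ ℓ)
    C = ⟨ (λ y → y ≈ g) ⟩

    -- h is the inverse of the generator; every element of C is gᵃhᵇ.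
    h : Carrier
    h = g ⁻¹

    gh≈hg : Commute g h
    gh≈hg = trans (inverseʳ g) (sym (inverseˡ g))

    pow-cancel : ∀ n → (pow g n ∙ pow h n) ≈ ε
    pow-cancel zero = identityˡ ε
    pow-cancel (suc n) = begin
      (g ∙ pow g n) ∙ (h ∙ pow h n)  ≈⟨ interchange (pow-commute gh≈hg n) ⟩
      (g ∙ h) ∙ (pow g n ∙ pow h n)  ≈⟨ ∙-cong (inverseʳ g) (pow-cancel n) ⟩
      ε ∙ ε                          ≈⟨ identityˡ ε ⟩
      ε                              ∎

    normal-form : ∀ {x} → C x → ∃₂ λ a b → x ≈ (pow g a ∙ pow h b)
    normal-form (gen x≈g) = 1 , 0 , trans x≈g (trans (sym (identityʳ g)) (sym (identityʳ _)))
    normal-form unit = 0 , 0 , sym (identityˡ ε)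
    normal-form (mul {x} {y} Cx Cy) with normal-form Cx | normal-form Cy
    ... | a , b , x≈ | a′ , b′ , y≈ = a + a′ , b + b′ , (begin
      x ∙ y                                         ≈⟨ ∙-cong x≈ y≈ ⟩
      (pow g a ∙ pow h b) ∙ (pow g a′ ∙ pow h b′)   ≈⟨ interchange (sym (pows-commute gh≈hg a′ b)) ⟩
      (pow g a ∙ pow g a′) ∙ (pow h b ∙ pow h b′)   ≈⟨ ∙-cong (pow-+ g a a′) (pow-+ h b b′) ⟨
      pow g (a + a′) ∙ pow h (b + b′)               ∎)
    normal-form (inv {x} Cx) with normal-form Cx
    ... | a , b , x≈ = b , a , (begin
      x ⁻¹                       ≈⟨ ⁻¹-cong x≈ ⟩
      (pow g a ∙ pow h b) ⁻¹     ≈⟨ ⁻¹-anti-homo-∙ _ _ ⟩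
      pow h b ⁻¹ ∙ pow g a ⁻¹    ≈⟨ ∙-cong (inverseˡ-unique _ _ (pow-cancel b)) (inverseʳ-unique _ _ (pow-cancel a)) ⟨
      pow g b ∙ pow h a          ∎)
    normal-form (resp y≈x Cy) with normal-form Cy
    ... | a , b , y≈ = a , b , trans (sym y≈x) y≈

    -- Every involution of C is a nonnegative power of g: write x = gᵃhᵇ;
    -- if b ≤ a then x = g^(a-b), otherwise x = (g^(b-a))⁻¹ = x⁻¹ = g^(b-a).
    involution-is-power : ∀ {x} → C x → (x ∙ x) ≈ ε → ∃ λ i → x ≈ pow g i
    involution-is-power {x} Cx x² with normal-form Cx
    ... | a , b , x≈ with ≤-total b a
    ...   | inj₁ b≤a = a ∸ b , (begin
      x                                    ≈⟨ x≈ ⟩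
      pow g a ∙ pow h b                    ≈⟨ ∙-congʳ (pow-split g b≤a) ⟩
      (pow g b ∙ pow g (a ∸ b)) ∙ pow h b  ≈⟨ ∙-congʳ (pows-commute refl b (a ∸ b)) ⟩
      (pow g (a ∸ b) ∙ pow g b) ∙ pow h b  ≈⟨ assoc _ _ _ ⟩
      pow g (a ∸ b) ∙ (pow g b ∙ pow h b)  ≈⟨ ∙-congˡ (pow-cancel b) ⟩
      pow g (a ∸ b) ∙ ε                    ≈⟨ identityʳ _ ⟩
      pow g (a ∸ b)                        ∎)
    ...   | inj₂ a≤b = b ∸ a , (begin
      x                                    ≈⟨ involution-self-inverse x² ⟨
      x ⁻¹                                 ≈⟨ ⁻¹-cong x≈ ⟩
      (pow g a ∙ pow h b) ⁻¹               ≈⟨ ⁻¹-cong (∙-congˡ (pow-split h a≤b)) ⟩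
      (pow g a ∙ (pow h a ∙ pow h (b ∸ a))) ⁻¹  ≈⟨ ⁻¹-cong (assoc _ _ _) ⟨
      ((pow g a ∙ pow h a) ∙ pow h (b ∸ a)) ⁻¹  ≈⟨ ⁻¹-cong (trans (∙-congʳ (pow-cancel a)) (identityˡ _)) ⟩
      pow h (b ∸ a) ⁻¹                     ≈⟨ inverseˡ-unique _ _ (pow-cancel (b ∸ a)) ⟨
      pow g (b ∸ a)                        ∎)

    -- Descent: if gⁱ, gʲ were distinct involutions with i ≤ j, then so
    -- would be gⁱ, g^(j-i) (by `shorten`), with smaller exponent sum.
    powers-not-distinct-involutions : ∀ n i j → i + j ≤ n →
      ¬ DistinctInvolutions (pow g i) (pow g j)
    powers-not-distinct-involutions n zero j _ ((_ , ε≉ε) , _) = ε≉ε refl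
    powers-not-distinct-involutions n (suc i) zero _ (_ , (_ , ε≉ε) , _) = ε≉ε refl
    powers-not-distinct-involutions zero (suc i) (suc j) ()
    powers-not-distinct-involutions (suc n) (suc i) (suc j) le distinct with ≤-total i j
    ... | inj₁ i≤j =
      powers-not-distinct-involutions n (suc i) (j ∸ i) (descent-bound i≤j le)
        (shorten (pows-commute refl (suc i) (j ∸ i)) (pow-split g (s≤s i≤j)) distinct)
    ... | inj₂ j≤i =
      powers-not-distinct-involutions n (suc j) (i ∸ j)
        (descent-bound j≤i (≡.subst (_≤ suc n) (+-comm (suc i) (suc j)) le))
        (shorten (pows-commute refl (suc j) (i ∸ j)) (pow-split g (s≤s j≤i)) (distinct-sym distinct))

    at-most-one-involution : ∀ {x y} → C x → C y → ¬ DistinctInvolutions x y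
    at-most-one-involution Cx Cy distinct@((x² , _) , (y² , _) , _)
      with involution-is-power Cx x² | involution-is-power Cy y²
    ... | i , x≈gⁱ | j , y≈gʲ =
      powers-not-distinct-involutions (i + j) i j ≤-refl
        (distinct-resp x≈gⁱ y≈gʲ distinct)

  module Semidirect
    {k n} {K : Carrier → Set k} {N : Carrier → Set n} (g : Carrier)
    (N-subgroup : IsSubgroup N)
    (N-no-involution : ∀ {x} → N x → (x ∙ x) ≈ ε → x ≈ ε)
    (N-normal : ∀ {x h} → N x → K h → N ((h ∙ x) ∙ (h ⁻¹)))
    (C⊆K : Cyclic.C g ⊆ K)
    (N∩C-trivial : ∀ {x} → N x → Cyclic.C g x → x ≈ ε)
    (K⊆NC : ∀ {x} → K x → ∃₂ λ m z → N m × Cyclic.C g z × x ≈ (m ∙ z))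
    where
    open Cyclic g using (C; at-most-one-involution)
    open IsSubgroup N-subgroup

    twisted-∈N : ∀ {m z m′} → N m → C z → N m′ → N (m ∙ ((z ∙ m′) ∙ z ⁻¹))
    twisted-∈N Nm Cz Nm′ = ∙-closed Nm (N-normal Nm′ (C⊆K Cz))

    -- The ⟨g⟩-component of an involution x = mz is an involution:
    -- z² ∈ N (as x² = m(zmz⁻¹)·z²) and z² ∈ ⟨g⟩, so z² = 1;
    -- and z ≠ 1, since otherwise x ∈ N would be an involution.
    involution-component : ∀ {x} → K x → IsInvolution x →
      ∃₂ λ m z → N m × C z × IsInvolution z × x ≈ (m ∙ z)
    involution-component {x} Kx (x² , x≉ε) with K⊆NC Kx
    ... | m , z , Nm , Cz , x≈mz = m , z , Nm , Cz , (z² , z≉ε) , x≈mz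
      where
      m′ = m ∙ ((z ∙ m) ∙ z ⁻¹)
      m′z²≈ε : (m′ ∙ (z ∙ z)) ≈ ε
      m′z²≈ε = begin
        m′ ∙ (z ∙ z)       ≈⟨ twisted-product m z m ⟨
        (m ∙ z) ∙ (m ∙ z)  ≈⟨ ∙-cong x≈mz x≈mz ⟨
        x ∙ x              ≈⟨ x² ⟩
        ε                  ∎
      z²∈N : N (z ∙ z)
      z²∈N = resp-≈ (sym (inverseʳ-unique _ _ m′z²≈ε)) (⁻¹-closed (twisted-∈N Nm Cz Nm))
      z² : (z ∙ z) ≈ ε
      z² = N∩C-trivial z²∈N (mul Cz Cz)
      z≉ε : ¬ (z ≈ ε)
      z≉ε z≈ε = x≉ε (N-no-involution (resp-≈ (sym x≈m) Nm) x²)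
        where
        x≈m : x ≈ m
        x≈m = trans x≈mz (trans (∙-congˡ z≈ε) (identityʳ m))

    no-commuting-involutions : ∀ {a b} → K a → K b → DistinctInvolutions a b →
                               ((a ∙ b) ∙ (a ∙ b)) ≈ ε → ⊥
    no-commuting-involutions {a} {b} Ka Kb (a-inv , b-inv@(b² , _) , a≉b) ab²
      with involution-component Ka a-inv | involution-component Kb b-inv
    ... | m , z , Nm , Cz , z-inv@(z² , _) , a≈mz | m′ , z′ , Nm′ , Cz′ , z′-inv , b≈m′z′ =
      at-most-one-involution Cz Cz′ (z-inv , z′-inv , z≉z′)
      where
      -- equal components force ab ∈ N, hence ab = 1 and a = b⁻¹ = b
      z≉z′ : ¬ (z ≈ z′)
      z≉z′ z≈z′ = a≉b (begin
        a     ≈⟨ inverseˡ-unique a b ab≈ε ⟩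
        b ⁻¹  ≈⟨ involution-self-inverse b² ⟩
        b     ∎)
        where
        ab≈ : (a ∙ b) ≈ (m ∙ ((z ∙ m′) ∙ z ⁻¹))
        ab≈ = begin
          a ∙ b                                     ≈⟨ ∙-cong a≈mz (trans b≈m′z′ (∙-congˡ (sym z≈z′))) ⟩
          (m ∙ z) ∙ (m′ ∙ z)                        ≈⟨ twisted-product m z m′ ⟩
          (m ∙ ((z ∙ m′) ∙ z ⁻¹)) ∙ (z ∙ z)         ≈⟨ ∙-congˡ z² ⟩
          (m ∙ ((z ∙ m′) ∙ z ⁻¹)) ∙ ε               ≈⟨ identityʳ _ ⟩
          m ∙ ((z ∙ m′) ∙ z ⁻¹)                     ∎
        ab≈ε : (a ∙ b) ≈ ε
        ab≈ε = N-no-involution (resp-≈ (sym ab≈) (twisted-∈N Nm Cz Nm′)) ab²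

  -- A subgroup of the shape E_{p^m} ⋊ Z_d with p odd contains no two
  -- distinct commuting involutions: elements of N have odd order p.
  semidirect-no-commuting-involutions :
    ∀ {k} {K : Carrier → Set k} {p m d a b} → IsSubgroup K →
    (∃ λ j → p ≡ suc (j * 2)) → IsSemidirectEZ K p m d →
    K a → K b → DistinctInvolutions a b → ((a ∙ b) ∙ (a ∙ b)) ≈ ε → ⊥
  semidirect-no-commuting-involutions K-subgroup (j , ≡.refl)
      (N , g , N-subgroup , _ , _ , _ , exponent-p , N-normal , Kg , _ , N∩C-trivial , K⊆NC) =
    Semidirect.no-commuting-involutions g N-subgroup
      (λ Nx x² → involution-odd-order-trivial j x² (exponent-p Nx))
      N-normal (⟨⟩-least K-subgroup (λ x≈g → IsSubgroup.resp-≈ K-subgroup (sym x≈g) Kg))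
      N∩C-trivial K⊆NC

-- In a string C-group, two generators ρᵢ, ρⱼ of G[J] with |i - j| ≥ 2
-- are distinct commuting involutions, so G[J] is not E ⋊ Z_d.
lemma4p5 : ∀ {c ℓ c' ℓ'} (p r : ℕ) → Prime p → p ≢ 2 → 1 ≤ r →
    (F : Field c' ℓ') → FieldOfOrder F (p ^ r) →
    (G : Group c ℓ) → IsoToPGL2 G F → (S : StringCGroup4 G) →
    ∀ (m d : ℕ) → m ≤ r → d ∣ (p ^ r ∸ 1) → d ∣ (p ^ m ∸ 1) →
    ¬ GroupNotions.IsSemidirectEZ G (StringCGroup4.G[_] S I₁₂₃) p m d ×
    ¬ GroupNotions.IsSemidirectEZ G (StringCGroup4.G[_] S I₀₁₂) p m d
lemma4p5 p _ p-prime p≢2 _ _ _ G _ S m d _ _ _ =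
    not-semidirect I₁₂₃ (# 1) (# 3) (there here) (there (there (there here))) (λ ()) (s≤s (s≤s z≤n)) ,
    not-semidirect I₀₁₂ (# 0) (# 2) here (there (there here)) (λ ()) (s≤s (s≤s z≤n))
  where
  open Group G
  open GroupNotions G using (gen; IsSemidirectEZ)
  open GroupFacts G
  open StringCGroup4 S

  not-semidirect : ∀ J (i j : Fin 4) → i ∈ J → j ∈ J → i ≢ j →
                   2 ≤ (toℕ i ∸ toℕ j) + (toℕ j ∸ toℕ i) → ¬ IsSemidirectEZ G[ J ] p m d
  not-semidirect J i j i∈J j∈J i≢j far semidirect =
    semidirect-no-commuting-involutions {m = m} ⟨⟩-isSubgroup (odd-prime p-prime p≢2) semidirect
      (gen (i , i∈J , refl)) (gen (j , j∈J , refl))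
      ((involution i , nontrivial i) , (involution j , nontrivial j) , distinct i j i≢j)
      (commuting i j far)
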